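{- For each integer $r$ and each non-negative integer $n$, \[ \sum_{k = 0}^n \binom {2k}{k} \binom {2(n - k)}{n-k}5^{n - k} F_{6k + r} = 4^n \sum_{k = 0}^n \binom nk^2 4^k F_{2k + r}, \qquad \sum_{k = 0}^n \binom {2k}{k} \binom {2(n - k)}{n-k}5^{n - k} L_{6k + r} = 4^n \sum_{k = 0}^n \binom nk^2 4^k L_{2k + r}. \]
   Context: $F_j$ and $L_j$ denote the Fibonacci and Lucas numbers: $F_0=0,F_1=1$, $L_0=2,L_1=1$, both satisfying $X_j=X_{j-1}+X_{j-2}$, extended to all integer indices via the recurrence (so $F_{ -j}=(-1)^{j+1}F_j$, $L_{ -j}=(-1)^jL_j$). -}

module Defs where

open import Data.Nat as ℕ using (ℕ; zero; suc)
open import Data.Nat.Combinatorics using (_C_)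
open import Data.Integer as ℤ using (ℤ; +_; -[1+_]; -_)

fibℕ : ℕ → ℕ
fibℕ 0 = 0
fibℕ 1 = 1
fibℕ (suc (suc n)) = fibℕ (suc n) ℕ.+ fibℕ n

lucℕ : ℕ → ℕ
lucℕ 0 = 2
lucℕ 1 = 1
lucℕ (suc (suc n)) = lucℕ (suc n) ℕ.+ lucℕ n

sgn : ℕ → ℤ
sgn zero = + 1
sgn (suc n) = - sgn n

-- Extension to all integer indices (the unique extension satisfying the
-- recurrence): F_{-j} = (-1)^{j+1} F_j, L_{-j} = (-1)^j L_j.
F : ℤ → ℤ
F (+ n) = + fibℕ n
F -[1+ m ] = sgn m ℤ.* + fibℕ (suc m)          -- j = m+1, (-1)^{j+1} = (-1)^m

L : ℤ → ℤ
L (+ n) = + lucℕ n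
L -[1+ m ] = - (sgn m ℤ.* + lucℕ (suc m))

sumTo : ℕ → (ℕ → ℤ) → ℤ
sumTo zero f = f 0
sumTo (suc n) f = sumTo n f ℤ.+ f (suc n)

-- Both identities are images of one identity in ℤ[φ], φ² = φ + 1. For a sequence G with
-- G (s + 2) = G (s + 1) + G s, the additive map a + b φ ↦ a G r + b G (r + 1) turns
-- multiplication by φ into the shift r ↦ r + 1, hence sends φ ^ j to G (j + r). It therefore
-- suffices to show
--   ∑ₖ C(2k,k) C(2(n-k),n-k) y^k z^(n-k) = 4^n ∑ₖ C(n,k)² u^k   for y = φ⁶, z = 5, u = 4φ².
-- This holds in any torsion-free commutative ring as soon as y + z = 2 (1 + u) and
-- y z = (1 - u)². The left side is the convolution of the coefficients of (1 - 4yt)^(-1/2) and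
-- (1 - 4zt)^(-1/2), so it is the coefficient sequence of (1 - 4(y + z)t + 16yz t²)^(-1/2); the
-- right side is 4^n times the Legendre-type polynomial ∑ₖ C(n,k)² u^k, the coefficient sequence of
-- (1 - 2(1 + u)t + (1 - u)² t²)^(-1/2). Both sides thus satisfy the same three-term recurrence
-- with the same two initial values, and torsion-freeness lets the recurrence determine the sequence.

module Submission where

open import Defs

open import Data.Nat as ℕ using (ℕ; zero; suc; _∸_; _≤_)
import Data.Nat.Properties as ℕ
open import Data.Nat.Combinatorics
  using (_C_; nCk+nC[k+1]≡[n+1]C[k+1]; nC1≡n; nCk≡nC[n∸k]; k>n⇒nCk≡0)
open import Data.Nat.Tactic.RingSolver using (solve-∀)
open import Data.Integer as ℤ using (ℤ; +_; -[1+_])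
import Data.Integer.Properties as ℤ
open import Data.Integer.Tactic.RingSolver using () renaming (solve to ℤ-solve; solve-∀ to ℤ-solve-∀)
open import Data.List.Base using ([]; _∷_)
open import Data.Product using (_×_; _,_; proj₁)
open import Algebra.Structures using (IsCommutativeRing)
open import Algebra.Bundles using (CommutativeRing)
open import Level using (_⊔_)
open import Relation.Binary.PropositionalEquality as ≡ using (_≡_; refl; module ≡-Reasoning)

[k+1]*[n+1]C[k+1]≡[n+1]*nCk : ∀ n k → suc k ℕ.* (suc n C suc k) ≡ suc n ℕ.* (n C k)
[k+1]*[n+1]C[k+1]≡[n+1]*nCk zero    zero    = refl
[k+1]*[n+1]C[k+1]≡[n+1]*nCk zero    (suc k) = ℕ.*-zeroʳ (2 ℕ.+ k)
[k+1]*[n+1]C[k+1]≡[n+1]*nCk (suc n) zero    =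
  ≡.trans (ℕ.*-identityˡ _) (≡.trans (nC1≡n (2 ℕ.+ n)) (≡.sym (ℕ.*-identityʳ _)))
[k+1]*[n+1]C[k+1]≡[n+1]*nCk (suc n) (suc k) = begin
  (2 ℕ.+ k) ℕ.* ((2 ℕ.+ n) C (2 ℕ.+ k))
    ≡⟨ ≡.cong ((2 ℕ.+ k) ℕ.*_) (≡.sym (nCk+nC[k+1]≡[n+1]C[k+1] (suc n) (suc k))) ⟩
  (2 ℕ.+ k) ℕ.* (a ℕ.+ b)
    ≡⟨ ℕ.*-distribˡ-+ (2 ℕ.+ k) a b ⟩
  (a ℕ.+ suc k ℕ.* a) ℕ.+ (2 ℕ.+ k) ℕ.* b
    ≡⟨ ≡.cong₂ (λ x y → (a ℕ.+ x) ℕ.+ y) ([k+1]*[n+1]C[k+1]≡[n+1]*nCk n k) ([k+1]*[n+1]C[k+1]≡[n+1]*nCk n (suc k)) ⟩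
  (a ℕ.+ suc n ℕ.* (n C k)) ℕ.+ suc n ℕ.* (n C suc k)
    ≡⟨ ≡.trans (ℕ.+-assoc a _ _) (≡.cong (a ℕ.+_) (≡.sym (ℕ.*-distribˡ-+ (suc n) (n C k) _))) ⟩
  a ℕ.+ suc n ℕ.* (n C k ℕ.+ n C suc k)
    ≡⟨ ≡.cong (λ x → a ℕ.+ suc n ℕ.* x) (nCk+nC[k+1]≡[n+1]C[k+1] n k) ⟩
  (2 ℕ.+ n) ℕ.* a ∎
  where
  open ≡-Reasoning
  a = suc n C suc k
  b = suc n C (2 ℕ.+ k)

centralBinomial : ℕ → ℕ
centralBinomial n = (2 ℕ.* n) C n

centralBinomial-suc : ∀ n →
  suc n ℕ.* centralBinomial (suc n) ≡ 4 ℕ.* (n ℕ.* centralBinomial n) ℕ.+ 2 ℕ.* centralBinomial n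
centralBinomial-suc n = begin
  suc n ℕ.* ((2 ℕ.* suc n) C suc n)
    ≡⟨ ≡.cong (λ m → suc n ℕ.* (m C suc n)) (ℕ.*-suc 2 n) ⟩
  suc n ℕ.* ((2 ℕ.+ 2 ℕ.* n) C suc n)
    ≡⟨ ≡.cong (suc n ℕ.*_) (≡.sym (nCk+nC[k+1]≡[n+1]C[k+1] (suc (2 ℕ.* n)) n)) ⟩
  suc n ℕ.* (suc (2 ℕ.* n) C n ℕ.+ c)
    ≡⟨ ≡.cong (λ x → suc n ℕ.* (x ℕ.+ c)) symmetric ⟩
  suc n ℕ.* (c ℕ.+ c)
    ≡⟨ ℕ.*-distribˡ-+ (suc n) c c ⟩
  suc n ℕ.* c ℕ.+ suc n ℕ.* c
    ≡⟨ ≡.cong₂ ℕ._+_ absorb absorb ⟩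
  suc (2 ℕ.* n) ℕ.* centralBinomial n ℕ.+ suc (2 ℕ.* n) ℕ.* centralBinomial n
    ≡⟨ double n (centralBinomial n) ⟩
  4 ℕ.* (n ℕ.* centralBinomial n) ℕ.+ 2 ℕ.* centralBinomial n ∎
  where
  open ≡-Reasoning
  c = suc (2 ℕ.* n) C suc n
  symmetric : suc (2 ℕ.* n) C n ≡ c
  symmetric = ≡.trans (nCk≡nC[n∸k] (ℕ.≤-trans n≤2n (ℕ.n≤1+n _)))
                    (≡.cong (suc (2 ℕ.* n) C_) (≡.trans (ℕ.+-∸-assoc 1 n≤2n)
                          (≡.cong suc (≡.trans (ℕ.m+n∸m≡n n (n ℕ.+ 0)) (ℕ.+-identityʳ n)))))
    where
    n≤2n = ℕ.m≤n*m n 2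
  absorb : suc n ℕ.* c ≡ suc (2 ℕ.* n) ℕ.* centralBinomial n
  absorb = [k+1]*[n+1]C[k+1]≡[n+1]*nCk (2 ℕ.* n) n
  double : ∀ n b → suc (2 ℕ.* n) ℕ.* b ℕ.+ suc (2 ℕ.* n) ℕ.* b ≡ 4 ℕ.* (n ℕ.* b) ℕ.+ 2 ℕ.* b
  double = solve-∀

shift : (ℕ → ℕ) → ℕ → ℕ
shift c zero    = 0
shift c (suc k) = c k

binomial² : ℕ → ℕ → ℕ
binomial² n k = (n C k) ℕ.* (n C k)

legendre-step : ∀ m j {A B C P₁ Q₁ P₂} →
  B ℕ.+ A ≡ P₁ → C ℕ.+ B ≡ Q₁ → Q₁ ℕ.+ P₁ ≡ P₂ →
  (2 ℕ.+ j) ℕ.* P₁ ≡ suc m ℕ.* B → suc j ℕ.* Q₁ ≡ suc m ℕ.* C →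
  (2 ℕ.+ m) ℕ.* (P₂ ℕ.* P₂) ℕ.+ suc m ℕ.* (A ℕ.* A ℕ.+ C ℕ.* C)
    ≡ (3 ℕ.+ 2 ℕ.* m) ℕ.* (P₁ ℕ.* P₁ ℕ.+ Q₁ ℕ.* Q₁) ℕ.+ 2 ℕ.* suc m ℕ.* (B ℕ.* B)
-- The difference of the two sides is 2(B + C)((2 + j)P₁ - (1 + m)B) + 2(A + B)((1 + m)C - (1 + j)Q₁),
-- so adding the subtracted terms to both sides gives a subtraction-free polynomial identity.
legendre-step m j {A} {B} {C} refl refl refl absorbP absorbQ =
  ℕ.+-cancelʳ-≡ _ _ _ (≡.trans (≡.cong₂ correction absorbP (≡.sym absorbQ)) (identity m j A B C))
  where
  correction : ℕ → ℕ → ℕ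
  correction p q = (2 ℕ.+ m) ℕ.* (((C ℕ.+ B) ℕ.+ (B ℕ.+ A)) ℕ.* ((C ℕ.+ B) ℕ.+ (B ℕ.+ A)))
    ℕ.+ suc m ℕ.* (A ℕ.* A ℕ.+ C ℕ.* C) ℕ.+ (2 ℕ.* (B ℕ.+ C) ℕ.* p ℕ.+ 2 ℕ.* (A ℕ.+ B) ℕ.* q)
  identity : ∀ m j A B C →
    (2 ℕ.+ m) ℕ.* (((C ℕ.+ B) ℕ.+ (B ℕ.+ A)) ℕ.* ((C ℕ.+ B) ℕ.+ (B ℕ.+ A))) ℕ.+ suc m ℕ.* (A ℕ.* A ℕ.+ C ℕ.* C)
      ℕ.+ (2 ℕ.* (B ℕ.+ C) ℕ.* (suc m ℕ.* B) ℕ.+ 2 ℕ.* (A ℕ.+ B) ℕ.* (suc j ℕ.* (C ℕ.+ B)))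
    ≡ (3 ℕ.+ 2 ℕ.* m) ℕ.* ((B ℕ.+ A) ℕ.* (B ℕ.+ A) ℕ.+ (C ℕ.+ B) ℕ.* (C ℕ.+ B)) ℕ.+ 2 ℕ.* suc m ℕ.* (B ℕ.* B)
      ℕ.+ (2 ℕ.* (B ℕ.+ C) ℕ.* ((2 ℕ.+ j) ℕ.* (B ℕ.+ A)) ℕ.+ 2 ℕ.* (A ℕ.+ B) ℕ.* (suc m ℕ.* C))
  identity = solve-∀

legendre-coefficient : ∀ m k →
  (2 ℕ.+ m) ℕ.* binomial² (2 ℕ.+ m) k ℕ.+ suc m ℕ.* (binomial² m k ℕ.+ shift (shift (binomial² m)) k)
    ≡ (3 ℕ.+ 2 ℕ.* m) ℕ.* (binomial² (suc m) k ℕ.+ shift (binomial² (suc m)) k)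
      ℕ.+ 2 ℕ.* suc m ℕ.* shift (binomial² m) k
legendre-coefficient m zero = constant m
  where
  constant : ∀ m → (2 ℕ.+ m) ℕ.* 1 ℕ.+ suc m ℕ.* (1 ℕ.+ 0) ≡ (3 ℕ.+ 2 ℕ.* m) ℕ.* (1 ℕ.+ 0) ℕ.+ 2 ℕ.* suc m ℕ.* 0
  constant = solve-∀
legendre-coefficient m (suc zero) =
  linear m ((2 ℕ.+ m) C 1) (m C 1) (suc m C 1) (nC1≡n (2 ℕ.+ m)) (nC1≡n m) (nC1≡n (suc m))
  where
  linear : ∀ m a b c → a ≡ 2 ℕ.+ m → b ≡ m → c ≡ suc m →
    (2 ℕ.+ m) ℕ.* (a ℕ.* a) ℕ.+ suc m ℕ.* (b ℕ.* b ℕ.+ 0)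
      ≡ (3 ℕ.+ 2 ℕ.* m) ℕ.* (c ℕ.* c ℕ.+ 1 ℕ.* 1) ℕ.+ 2 ℕ.* suc m ℕ.* (1 ℕ.* 1)
  linear m _ _ _ refl refl refl = identity m
    where
    identity : ∀ m → (2 ℕ.+ m) ℕ.* ((2 ℕ.+ m) ℕ.* (2 ℕ.+ m)) ℕ.+ suc m ℕ.* (m ℕ.* m ℕ.+ 0)
      ≡ (3 ℕ.+ 2 ℕ.* m) ℕ.* (suc m ℕ.* suc m ℕ.+ 1 ℕ.* 1) ℕ.+ 2 ℕ.* suc m ℕ.* (1 ℕ.* 1)
    identity = solve-∀
legendre-coefficient m (suc (suc j)) =
  legendre-step m j (pascal m (suc j)) (pascal m j) (pascal (suc m) (suc j))
                (absorb m (suc j)) (absorb m j)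
  where
  pascal = nCk+nC[k+1]≡[n+1]C[k+1]
  absorb = [k+1]*[n+1]C[k+1]≡[n+1]*nCk

binomial²-vanishes : ∀ {n k} → n ℕ.< k → binomial² n k ≡ 0
binomial²-vanishes n<k = ≡.cong (λ x → x ℕ.* x) (k>n⇒nCk≡0 n<k)

module CentralBinomialConvolution {c ℓ} (R : CommutativeRing c ℓ) where

  open CommutativeRing R renaming (refl to ≈-refl)
  open import Algebra.Properties.Ring ring using (+-cancelʳ)
  open import Algebra.Properties.CommutativeSemigroup +-commutativeSemigroup using (interchange)
  open import Algebra.Properties.Semiring.Exp semiring using (_^_)
  open import Algebra.Properties.Semiring.Mult.TCOptimised semiring
    using () renaming (_×_ to _·_; ×-homo-+ to ·-homo-+; ×1-homo-* to ·1-homo-*)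
  open import Algebra.Solver.Ring.NaturalCoefficients.Default commutativeSemiring
    using (solve; _:+_; _:*_; _:=_; con)
  open import Relation.Binary.Reasoning.Setoid setoid

  ι : ℕ → Carrier
  ι n = n · 1#

  ι-+ : ∀ m n → ι (m ℕ.+ n) ≈ ι m + ι n
  ι-+ m n = ·-homo-+ 1# m n

  ι-* : ∀ m n → ι (m ℕ.* n) ≈ ι m * ι n
  ι-* = ·1-homo-*

  ι-suc : ∀ n → ι (suc n) ≈ 1# + ι n
  ι-suc = ι-+ 1

  ι-^ : ∀ m n → ι (m ℕ.^ n) ≈ ι m ^ n
  ι-^ m zero    = ≈-refl
  ι-^ m (suc n) = trans (ι-* m (m ℕ.^ n)) (*-congˡ (ι-^ m n))

  ∑ : ℕ → (ℕ → Carrier) → Carrier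
  ∑ zero    f = f 0
  ∑ (suc n) f = ∑ n f + f (suc n)

  syntax ∑ n (λ k → t) = ∑[ k ≤ n ] t

  ∑-cong : ∀ n {f g : ℕ → Carrier} → (∀ {k} → k ≤ n → f k ≈ g k) → ∑ n f ≈ ∑ n g
  ∑-cong zero    f≈g = f≈g ℕ.z≤n
  ∑-cong (suc n) f≈g = +-cong (∑-cong n (λ k≤n → f≈g (ℕ.m≤n⇒m≤1+n k≤n))) (f≈g ℕ.≤-refl)

  ∑-distrib-+ : ∀ n f g → ∑[ k ≤ n ] (f k + g k) ≈ ∑ n f + ∑ n g
  ∑-distrib-+ zero    f g = ≈-refl
  ∑-distrib-+ (suc n) f g = trans (+-congʳ (∑-distrib-+ n f g)) (interchange _ _ _ _)

  *-distribˡ-∑ : ∀ n x f → x * ∑ n f ≈ ∑[ k ≤ n ] (x * f k)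
  *-distribˡ-∑ zero    x f = ≈-refl
  *-distribˡ-∑ (suc n) x f = trans (distribˡ x _ _) (+-congʳ (*-distribˡ-∑ n x f))

  ∑-suc : ∀ n f → ∑ (suc n) f ≈ f 0 + ∑[ k ≤ n ] f (suc k)
  ∑-suc zero    f = ≈-refl
  ∑-suc (suc n) f = trans (+-congʳ (∑-suc n f)) (+-assoc _ _ _)

  ∑-reverse : ∀ n f → ∑ n f ≈ ∑[ k ≤ n ] f (n ∸ k)
  ∑-reverse zero    f = ≈-refl
  ∑-reverse (suc n) f = begin
    ∑ n f + f (suc n)                  ≈⟨ +-comm _ _ ⟩
    f (suc n) + ∑ n f                  ≈⟨ +-congˡ (∑-reverse n f) ⟩
    f (suc n) + ∑[ k ≤ n ] f (n ∸ k)   ≈⟨ ∑-suc n _ ⟨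
    ∑[ k ≤ suc n ] f (suc n ∸ k)       ∎

  infixl 7 _⋆_

  _⋆_ : (ℕ → Carrier) → (ℕ → Carrier) → ℕ → Carrier
  (f ⋆ g) n = ∑[ i ≤ n ] (f i * g (n ∸ i))

  ⋆-comm : ∀ f g n → (f ⋆ g) n ≈ (g ⋆ f) n
  ⋆-comm f g n = trans (∑-reverse n _) (∑-cong n swap)
    where
    swap : ∀ {i} → i ≤ n → f (n ∸ i) * g (n ∸ (n ∸ i)) ≈ g i * f (n ∸ i)
    swap i≤n = trans (*-comm _ _) (*-congʳ (reflexive (≡.cong g (ℕ.m∸[m∸n]≡n i≤n))))

  ⋆-congˡ : ∀ {f f′} g n → (∀ i → f i ≈ f′ i) → (f ⋆ g) n ≈ (f′ ⋆ g) n
  ⋆-congˡ g n f≈f′ = ∑-cong n (λ {i} _ → *-congʳ (f≈f′ i))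

  ⋆-suc : ∀ f g n → (f ⋆ g) (suc n) ≈ f 0 * g (suc n) + ((λ i → f (suc i)) ⋆ g) n
  ⋆-suc f g n = ∑-suc n _

  ⋆-distribʳ-+ : ∀ f f′ g n → ((λ i → f i + f′ i) ⋆ g) n ≈ (f ⋆ g) n + (f′ ⋆ g) n
  ⋆-distribʳ-+ f f′ g n = trans (∑-cong n (λ _ → distribʳ _ _ _)) (∑-distrib-+ n _ _)

  *-⋆ : ∀ x f g n → ((λ i → x * f i) ⋆ g) n ≈ x * (f ⋆ g) n
  *-⋆ x f g n = trans (∑-cong n (λ _ → *-assoc _ _ _)) (sym (*-distribˡ-∑ n x _))

  -- The Euler operator t d/dt on coefficient sequences.
  θ : (ℕ → Carrier) → ℕ → Carrier
  θ f i = ι i * f i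

  θ-⋆ : ∀ f g n → ι n * (f ⋆ g) n ≈ (θ f ⋆ g) n + (f ⋆ θ g) n
  θ-⋆ f g n = begin
    ι n * (f ⋆ g) n                                         ≈⟨ *-distribˡ-∑ n (ι n) _ ⟩
    ∑[ i ≤ n ] (ι n * (f i * g (n ∸ i)))                    ≈⟨ ∑-cong n leibniz ⟩
    ∑[ i ≤ n ] (θ f i * g (n ∸ i) + f i * θ g (n ∸ i))      ≈⟨ ∑-distrib-+ n _ _ ⟩
    (θ f ⋆ g) n + (f ⋆ θ g) n                               ∎
    where
    product-rule : ∀ I J a b → (I + J) * (a * b) ≈ I * a * b + a * (J * b)
    product-rule = solve 4 (λ I J a b → (I :+ J) :* (a :* b) := I :* a :* b :+ a :* (J :* b)) ≈-refl
    leibniz : ∀ {i} → i ≤ n → ι n * (f i * g (n ∸ i)) ≈ θ f i * g (n ∸ i) + f i * θ g (n ∸ i)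
    leibniz {i} i≤n = begin
      ι n * (f i * g (n ∸ i))                 ≈⟨ *-congʳ (reflexive (≡.cong ι (ℕ.m+[n∸m]≡n i≤n))) ⟨
      ι (i ℕ.+ (n ∸ i)) * (f i * g (n ∸ i))   ≈⟨ *-congʳ (ι-+ i (n ∸ i)) ⟩
      (ι i + ι (n ∸ i)) * (f i * g (n ∸ i))   ≈⟨ product-rule _ _ _ _ ⟩
      θ f i * g (n ∸ i) + f i * θ g (n ∸ i)   ∎

  -- f is the coefficient sequence of (1 - 4 y t)^(-1/2), that is (1 - 4 y t) f′ = 2 y f.
  CentralBinomialSeries : Carrier → (ℕ → Carrier) → Set ℓ
  CentralBinomialSeries y f = ∀ i → θ f (suc i) ≈ y * (ι 4 * θ f i + ι 2 * f i)

  centralBinomialSeries : ∀ y → CentralBinomialSeries y (λ i → ι (centralBinomial i) * y ^ i)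
  centralBinomialSeries y i = begin
    ι (suc i) * (ι (centralBinomial (suc i)) * (y * y ^ i))
      ≈⟨ *-assoc _ _ _ ⟨
    ι (suc i) * ι (centralBinomial (suc i)) * (y * y ^ i)
      ≈⟨ *-congʳ (ι-* (suc i) (centralBinomial (suc i))) ⟨
    ι (suc i ℕ.* centralBinomial (suc i)) * (y * y ^ i)
      ≈⟨ *-congʳ (reflexive (≡.cong ι (centralBinomial-suc i))) ⟩
    ι (4 ℕ.* (i ℕ.* b) ℕ.+ 2 ℕ.* b) * (y * y ^ i)
      ≈⟨ *-congʳ coefficient ⟩
    (ι 4 * (ι i * ι b) + ι 2 * ι b) * (y * y ^ i)
      ≈⟨ rearrange (ι i) (ι b) y (y ^ i) ⟩
    y * (ι 4 * (ι i * (ι b * y ^ i)) + ι 2 * (ι b * y ^ i)) ∎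
    where
    b = centralBinomial i
    coefficient : ι (4 ℕ.* (i ℕ.* b) ℕ.+ 2 ℕ.* b) ≈ ι 4 * (ι i * ι b) + ι 2 * ι b
    coefficient = trans (ι-+ (4 ℕ.* (i ℕ.* b)) (2 ℕ.* b)) (+-cong (trans (ι-* 4 (i ℕ.* b)) (*-congˡ (ι-* i b))) (ι-* 2 b))
    rearrange : ∀ I B y P → (ι 4 * (I * B) + ι 2 * B) * (y * P) ≈ y * (ι 4 * (I * (B * P)) + ι 2 * (B * P))
    rearrange = solve 4 (λ I B y P → (con 4 :* (I :* B) :+ con 2 :* B) :* (y :* P)
                                     := y :* (con 4 :* (I :* (B :* P)) :+ con 2 :* (B :* P))) ≈-refl

  θ⋆-suc : ∀ {y f} → CentralBinomialSeries y f → ∀ g n →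
           (θ f ⋆ g) (suc n) ≈ y * (ι 4 * (θ f ⋆ g) n + ι 2 * (f ⋆ g) n)
  θ⋆-suc {y} {f} series g n = begin
    (θ f ⋆ g) (suc n)
      ≈⟨ ⋆-suc (θ f) g n ⟩
    θ f 0 * g (suc n) + ((λ i → θ f (suc i)) ⋆ g) n
      ≈⟨ trans (+-congʳ vanishes) (+-identityˡ _) ⟩
    ((λ i → θ f (suc i)) ⋆ g) n
      ≈⟨ ⋆-congˡ g n series ⟩
    ((λ i → y * (ι 4 * θ f i + ι 2 * f i)) ⋆ g) n
      ≈⟨ *-⋆ y _ g n ⟩
    y * ((λ i → ι 4 * θ f i + ι 2 * f i) ⋆ g) n
      ≈⟨ *-congˡ (trans (⋆-distribʳ-+ _ _ g n) (+-cong (*-⋆ _ _ g n) (*-⋆ _ _ g n))) ⟩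
    y * (ι 4 * (θ f ⋆ g) n + ι 2 * (f ⋆ g) n) ∎
    where
    vanishes : θ f 0 * g (suc n) ≈ 0#
    vanishes = trans (*-congʳ (zeroˡ (f 0))) (zeroˡ _)

  -- The recurrence of the coefficients of (1 - 4 s t + 16 p t²)^(-1/2).
  Recurrence : Carrier → Carrier → (ℕ → Carrier) → Set ℓ
  Recurrence s p h = ∀ n →
    ι (2 ℕ.+ n) * h (2 ℕ.+ n) + ι (16 ℕ.* suc n) * (p * h n) ≈ ι (4 ℕ.* n ℕ.+ 6) * (s * h (suc n))

  recurrence-intro : ∀ {s p h} →
    (∀ n → (ι 2 + ι n) * h (2 ℕ.+ n) + ι 16 * (1# + ι n) * (p * h n) ≈ (ι 4 * ι n + ι 6) * (s * h (suc n))) →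
    Recurrence s p h
  recurrence-intro {s} {p} {h} rec n = begin
    ι (2 ℕ.+ n) * h (2 ℕ.+ n) + ι (16 ℕ.* suc n) * (p * h n)
      ≈⟨ +-cong (*-congʳ (ι-+ 2 n)) (*-congʳ sixteen) ⟩
    (ι 2 + ι n) * h (2 ℕ.+ n) + ι 16 * (1# + ι n) * (p * h n)
      ≈⟨ rec n ⟩
    (ι 4 * ι n + ι 6) * (s * h (suc n))
      ≈⟨ *-congʳ (trans (ι-+ (4 ℕ.* n) 6) (+-congʳ (ι-* 4 n))) ⟨
    ι (4 ℕ.* n ℕ.+ 6) * (s * h (suc n)) ∎
    where
    sixteen : ι (16 ℕ.* suc n) ≈ ι 16 * (1# + ι n)
    sixteen = trans (ι-* 16 (suc n)) (*-congˡ (ι-suc n))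

  TorsionFree : Set (c ⊔ ℓ)
  TorsionFree = ∀ n {x y} → ι (suc n) * x ≈ ι (suc n) * y → x ≈ y

  recurrence-unique : TorsionFree → ∀ {s p h h′} → Recurrence s p h → Recurrence s p h′ →
                      h 0 ≈ h′ 0 → h 1 ≈ h′ 1 → ∀ n → h n ≈ h′ n
  recurrence-unique cancel {s} {p} {h} {h′} rec rec′ h₀ h₁ n = proj₁ (consecutive n)
    where
    consecutive : ∀ n → h n ≈ h′ n × h (suc n) ≈ h′ (suc n)
    consecutive zero    = h₀ , h₁
    consecutive (suc n) with consecutive n
    ... | hₙ , hₙ₊₁ = hₙ₊₁ , cancel (suc n) (+-cancelʳ _ _ _ (begin
      ι (2 ℕ.+ n) * h (2 ℕ.+ n) + ι (16 ℕ.* suc n) * (p * h n)    ≈⟨ rec n ⟩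
      ι (4 ℕ.* n ℕ.+ 6) * (s * h (suc n))                         ≈⟨ *-congˡ (*-congˡ hₙ₊₁) ⟩
      ι (4 ℕ.* n ℕ.+ 6) * (s * h′ (suc n))                        ≈⟨ rec′ n ⟨
      ι (2 ℕ.+ n) * h′ (2 ℕ.+ n) + ι (16 ℕ.* suc n) * (p * h′ n)  ≈⟨ +-congˡ (*-congˡ (*-congˡ hₙ)) ⟨
      ι (2 ℕ.+ n) * h′ (2 ℕ.+ n) + ι (16 ℕ.* suc n) * (p * h n)   ∎))

  ⋆-recurrence : ∀ {y z f g} → CentralBinomialSeries y f → CentralBinomialSeries z g →
                 Recurrence (y + z) (y * z) (f ⋆ g)
  ⋆-recurrence {y} {z} {f} {g} f-series g-series = recurrence-intro step
    where
    h A B : ℕ → Carrier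
    h = f ⋆ g
    A = θ f ⋆ g
    B = f ⋆ θ g

    A-suc : ∀ n → A (suc n) ≈ y * (ι 4 * A n + ι 2 * h n)
    A-suc = θ⋆-suc f-series g

    B-suc : ∀ n → B (suc n) ≈ z * (ι 4 * B n + ι 2 * h n)
    B-suc n = begin
      B (suc n)
        ≈⟨ ⋆-comm f (θ g) (suc n) ⟩
      (θ g ⋆ f) (suc n)
        ≈⟨ θ⋆-suc g-series f n ⟩
      z * (ι 4 * (θ g ⋆ f) n + ι 2 * (g ⋆ f) n)
        ≈⟨ *-congˡ (+-cong (*-congˡ (⋆-comm (θ g) f n)) (*-congˡ (⋆-comm g f n))) ⟩
      z * (ι 4 * B n + ι 2 * h n) ∎

    -- a and b are only known through a + b, but the cross term z a + y b follows from the
    -- first-order recurrences one degree lower, so it is added to both sides and cancelled.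
    step : ∀ n → (ι 2 + ι n) * h (2 ℕ.+ n) + ι 16 * (1# + ι n) * (y * z * h n)
                 ≈ (ι 4 * ι n + ι 6) * ((y + z) * h (suc n))
    step n = +-cancelʳ X _ _ (begin
      (ι 2 + N) * h (2 ℕ.+ n) + M + X                                       ≈⟨ +-congʳ (+-congʳ degree₂) ⟩
      y * (ι 4 * a + ι 2 * h₁) + z * (ι 4 * b + ι 2 * h₁) + M + X           ≈⟨ regroup y z a b h₁ M ⟩
      ι 4 * (y + z) * (a + b) + ι 2 * (y + z) * h₁ + M                      ≈⟨ +-congʳ (+-congʳ (*-congˡ degree₁)) ⟩
      ι 4 * (y + z) * ((1# + N) * h₁) + ι 2 * (y + z) * h₁ + M              ≈⟨ collect y z N h₀ h₁ ⟩
      (ι 4 * N + ι 6) * ((y + z) * h₁) + ι 4 * (ι 4 * (y * z) * ((1# + N) * h₀)) ≈⟨ +-congˡ (*-congˡ cross) ⟨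
      (ι 4 * N + ι 6) * ((y + z) * h₁) + X                                  ∎)
      where
      N = ι n
      h₀ = h n
      h₁ = h (suc n)
      a = A (suc n)
      b = B (suc n)
      M = ι 16 * (1# + N) * (y * z * h₀)
      X = ι 4 * (z * a + y * b)

      degree₂ : (ι 2 + N) * h (2 ℕ.+ n) ≈ y * (ι 4 * a + ι 2 * h₁) + z * (ι 4 * b + ι 2 * h₁)
      degree₂ = trans (*-congʳ (sym (ι-+ 2 n))) (trans (θ-⋆ f g (2 ℕ.+ n)) (+-cong (A-suc (suc n)) (B-suc (suc n))))

      degree₁ : a + b ≈ (1# + N) * h₁
      degree₁ = trans (sym (θ-⋆ f g (suc n))) (*-congʳ (ι-suc n))

      gather : ∀ y z A B h → z * (y * (ι 4 * A + ι 2 * h)) + y * (z * (ι 4 * B + ι 2 * h)) ≈ ι 4 * (y * z) * ((A + B) + h)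
      gather = solve 5 (λ y z A B h → z :* (y :* (con 4 :* A :+ con 2 :* h)) :+ y :* (z :* (con 4 :* B :+ con 2 :* h))
                                     := con 4 :* (y :* z) :* ((A :+ B) :+ h)) ≈-refl

      cross : z * a + y * b ≈ ι 4 * (y * z) * ((1# + N) * h₀)
      cross = begin
        z * a + y * b
          ≈⟨ +-cong (*-congˡ (A-suc n)) (*-congˡ (B-suc n)) ⟩
        z * (y * (ι 4 * A n + ι 2 * h₀)) + y * (z * (ι 4 * B n + ι 2 * h₀))
          ≈⟨ gather y z (A n) (B n) h₀ ⟩
        ι 4 * (y * z) * ((A n + B n) + h₀)
          ≈⟨ *-congˡ (+-congʳ (θ-⋆ f g n)) ⟨
        ι 4 * (y * z) * (N * h₀ + h₀)
          ≈⟨ *-congˡ (solve 2 (λ N h → N :* h :+ h := (con 1 :+ N) :* h) ≈-refl N h₀) ⟩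
        ι 4 * (y * z) * ((1# + N) * h₀) ∎

      regroup : ∀ y z a b h M → y * (ι 4 * a + ι 2 * h) + z * (ι 4 * b + ι 2 * h) + M + ι 4 * (z * a + y * b)
                                ≈ ι 4 * (y + z) * (a + b) + ι 2 * (y + z) * h + M
      regroup = solve 6 (λ y z a b h M → y :* (con 4 :* a :+ con 2 :* h) :+ z :* (con 4 :* b :+ con 2 :* h) :+ M :+ con 4 :* (z :* a :+ y :* b)
                                         := con 4 :* (y :+ z) :* (a :+ b) :+ con 2 :* (y :+ z) :* h :+ M) ≈-refl

      collect : ∀ y z N h₀ h₁ → ι 4 * (y + z) * ((1# + N) * h₁) + ι 2 * (y + z) * h₁ + ι 16 * (1# + N) * (y * z * h₀)
                                ≈ (ι 4 * N + ι 6) * ((y + z) * h₁) + ι 4 * (ι 4 * (y * z) * ((1# + N) * h₀))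
      collect = solve 5 (λ y z N h₀ h₁ → con 4 :* (y :+ z) :* ((con 1 :+ N) :* h₁) :+ con 2 :* (y :+ z) :* h₁ :+ con 16 :* (con 1 :+ N) :* (y :* z :* h₀)
                                         := (con 4 :* N :+ con 6) :* ((y :+ z) :* h₁) :+ con 4 :* (con 4 :* (y :* z) :* ((con 1 :+ N) :* h₀))) ≈-refl

  polynomial : Carrier → (ℕ → ℕ) → ℕ → Carrier
  polynomial w c M = ∑[ k ≤ M ] (ι (c k) * w ^ k)

  module _ (w : Carrier) where

    polynomial-cong : ∀ {c d} M → (∀ k → c k ≡ d k) → polynomial w c M ≈ polynomial w d M
    polynomial-cong M c≡d = ∑-cong M (λ {k} _ → *-congʳ (reflexive (≡.cong ι (c≡d k))))

    polynomial-+ : ∀ c d M → polynomial w (λ k → c k ℕ.+ d k) M ≈ polynomial w c M + polynomial w d M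
    polynomial-+ c d M = trans (∑-cong M (λ {k} _ → trans (*-congʳ (ι-+ (c k) (d k))) (distribʳ _ _ _)))
                               (∑-distrib-+ M _ _)

    polynomial-* : ∀ a c M → polynomial w (λ k → a ℕ.* c k) M ≈ ι a * polynomial w c M
    polynomial-* a c M = trans (∑-cong M (λ {k} _ → trans (*-congʳ (ι-* a (c k))) (*-assoc _ _ _)))
                               (sym (*-distribˡ-∑ M (ι a) _))

    polynomial-shift : ∀ c M → w * polynomial w c M ≈ polynomial w (shift c) (suc M)
    polynomial-shift c zero    = solve 2 (λ w C → w :* (C :* con 1) := con 0 :* con 1 :+ C :* (w :* con 1)) ≈-refl w (ι (c 0))
    polynomial-shift c (suc M) = trans (distribˡ w _ _) (+-cong (polynomial-shift c M) (x∙yz≈y∙xz w _ _))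
      where open import Algebra.Properties.CommutativeSemigroup *-commutativeSemigroup using (x∙yz≈y∙xz)

    polynomial-extend : ∀ c M → c (suc M) ≡ 0 → polynomial w c (suc M) ≈ polynomial w c M
    polynomial-extend c M c≡0 =
      trans (+-congˡ (trans (*-congʳ (reflexive (≡.cong ι c≡0))) (zeroˡ _))) (+-identityʳ _)

    binomial²-polynomial : ℕ → Carrier
    binomial²-polynomial n = polynomial w (binomial² n) n

    -- (m + 2) P (m + 2) = (2m + 3)(1 + w) P (m + 1) - (m + 1)(1 - w)² P m, without subtraction.
    binomial²-polynomial-recurrence : ∀ m → let P = binomial²-polynomial in
      ι (2 ℕ.+ m) * P (2 ℕ.+ m) + ι (suc m) * (P m + w * (w * P m))
        ≈ ι (3 ℕ.+ 2 ℕ.* m) * (P (suc m) + w * P (suc m)) + ι (2 ℕ.* suc m) * (w * P m)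
    binomial²-polynomial-recurrence m = begin
      ι (2 ℕ.+ m) * P (2 ℕ.+ m) + ι (suc m) * (P m + w * (w * P m))
        ≈⟨ +-congˡ (*-congˡ (+-cong pad₀ shift₀²)) ⟨
      ι (2 ℕ.+ m) * Q (binomial² (2 ℕ.+ m)) + ι (suc m) * (Q (binomial² m) + Q (shift (shift (binomial² m))))
        ≈⟨ trans (polynomial-+ (λ k → (2 ℕ.+ m) ℕ.* b₂ k) (λ k → suc m ℕ.* (b k ℕ.+ shift (shift b) k)) M)
                 (+-cong (polynomial-* (2 ℕ.+ m) b₂ M)
                         (trans (polynomial-* (suc m) (λ k → b k ℕ.+ shift (shift b) k) M)
                                (*-congˡ (polynomial-+ b (shift (shift b)) M)))) ⟨
      Q (λ k → (2 ℕ.+ m) ℕ.* binomial² (2 ℕ.+ m) k ℕ.+ suc m ℕ.* (binomial² m k ℕ.+ shift (shift (binomial² m)) k))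
        ≈⟨ polynomial-cong M (legendre-coefficient m) ⟩
      Q (λ k → (3 ℕ.+ 2 ℕ.* m) ℕ.* (binomial² (suc m) k ℕ.+ shift (binomial² (suc m)) k) ℕ.+ 2 ℕ.* suc m ℕ.* shift (binomial² m) k)
        ≈⟨ trans (polynomial-+ (λ k → (3 ℕ.+ 2 ℕ.* m) ℕ.* (b₁ k ℕ.+ shift b₁ k)) (λ k → 2 ℕ.* suc m ℕ.* shift b k) M)
                 (+-cong (trans (polynomial-* (3 ℕ.+ 2 ℕ.* m) (λ k → b₁ k ℕ.+ shift b₁ k) M)
                                (*-congˡ (polynomial-+ b₁ (shift b₁) M)))
                         (polynomial-* (2 ℕ.* suc m) (shift b) M)) ⟩
      ι (3 ℕ.+ 2 ℕ.* m) * (Q (binomial² (suc m)) + Q (shift (binomial² (suc m)))) + ι (2 ℕ.* suc m) * Q (shift (binomial² m))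
        ≈⟨ +-cong (*-congˡ (+-cong pad₁ shift₁)) (*-congˡ shift₀) ⟩
      ι (3 ℕ.+ 2 ℕ.* m) * (P (suc m) + w * P (suc m)) + ι (2 ℕ.* suc m) * (w * P m) ∎
      where
      P = binomial²-polynomial
      M = 2 ℕ.+ m
      b b₁ b₂ : ℕ → ℕ
      b = binomial² m
      b₁ = binomial² (suc m)
      b₂ = binomial² (2 ℕ.+ m)
      Q : (ℕ → ℕ) → Carrier
      Q c = polynomial w c M
      pad₀ : Q b ≈ P m
      pad₀ = trans (polynomial-extend b (suc m) (binomial²-vanishes (ℕ.m<n⇒m<1+n (ℕ.n<1+n m))))
                 (polynomial-extend b m (binomial²-vanishes (ℕ.n<1+n m)))
      shift₀ : Q (shift b) ≈ w * P m
      shift₀ = trans (polynomial-extend (shift b) (suc m) (binomial²-vanishes (ℕ.n<1+n m))) (sym (polynomial-shift b m))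
      shift₀² : Q (shift (shift b)) ≈ w * (w * P m)
      shift₀² = sym (trans (*-congˡ (polynomial-shift b m)) (polynomial-shift (shift b) (suc m)))
      pad₁ : Q b₁ ≈ P (suc m)
      pad₁ = polynomial-extend b₁ (suc m) (binomial²-vanishes (ℕ.n<1+n (suc m)))
      shift₁ : Q (shift b₁) ≈ w * P (suc m)
      shift₁ = sym (polynomial-shift b₁ (suc m))

  scaled-binomial²-recurrence : ∀ {s p u} → s ≈ ι 2 * (1# + u) → p + ι 2 * u ≈ 1# + u * u →
                         Recurrence s p (λ n → ι (4 ℕ.^ n) * binomial²-polynomial u n)
  scaled-binomial²-recurrence {s} {p} {u} s≈ p≈ = recurrence-intro step
    where
    step : ∀ n → let Y = λ n → ι (4 ℕ.^ n) * binomial²-polynomial u n in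
           (ι 2 + ι n) * Y (2 ℕ.+ n) + ι 16 * (1# + ι n) * (p * Y n) ≈ (ι 4 * ι n + ι 6) * (s * Y (suc n))
    step n = +-cancelʳ X _ _ (begin
      (ι 2 + N) * (ι (4 ℕ.^ (2 ℕ.+ n)) * T₂) + ι 16 * (1# + N) * (p * (v * T₀)) + X
        ≈⟨ +-congʳ (+-congʳ (*-congˡ (*-congʳ (trans (ι-* 4 (4 ℕ.^ suc n)) (*-congˡ (ι-* 4 (4 ℕ.^ n))))))) ⟩
      (ι 2 + N) * (ι 4 * (ι 4 * v) * T₂) + ι 16 * (1# + N) * (p * (v * T₀)) + X
        ≈⟨ factor N v T₂ T₀ p u ⟩
      ι 16 * v * ((ι 2 + N) * T₂ + (1# + N) * ((p + ι 2 * u) * T₀))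
        ≈⟨ *-congˡ (+-congˡ (*-congˡ (trans (*-congʳ p≈) (square u T₀)))) ⟩
      ι 16 * v * ((ι 2 + N) * T₂ + (1# + N) * (T₀ + u * (u * T₀)))
        ≈⟨ *-congˡ T-recurrence ⟩
      ι 16 * v * ((ι 3 + ι 2 * N) * (T₁ + u * T₁) + ι 2 * (1# + N) * (u * T₀))
        ≈⟨ expand N v T₁ T₀ u ⟩
      (ι 4 * N + ι 6) * (ι 2 * (1# + u) * (ι 4 * v * T₁)) + X
        ≈⟨ +-congʳ (*-congˡ (*-cong (sym s≈) (*-congʳ (sym (ι-* 4 (4 ℕ.^ n)))))) ⟩
      (ι 4 * N + ι 6) * (s * (ι (4 ℕ.^ suc n) * T₁)) + X ∎)
      where
      N = ι n
      v = ι (4 ℕ.^ n)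
      T₀ = binomial²-polynomial u n
      T₁ = binomial²-polynomial u (suc n)
      T₂ = binomial²-polynomial u (2 ℕ.+ n)
      X = ι 16 * v * (ι 2 * (1# + N) * (u * T₀))

      T-recurrence : (ι 2 + N) * T₂ + (1# + N) * (T₀ + u * (u * T₀))
                  ≈ (ι 3 + ι 2 * N) * (T₁ + u * T₁) + ι 2 * (1# + N) * (u * T₀)
      T-recurrence = begin
        (ι 2 + N) * T₂ + (1# + N) * (T₀ + u * (u * T₀))
          ≈⟨ +-cong (*-congʳ (ι-+ 2 n)) (*-congʳ (ι-suc n)) ⟨
        ι (2 ℕ.+ n) * T₂ + ι (suc n) * (T₀ + u * (u * T₀))
          ≈⟨ binomial²-polynomial-recurrence u n ⟩
        ι (3 ℕ.+ 2 ℕ.* n) * (T₁ + u * T₁) + ι (2 ℕ.* suc n) * (u * T₀)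
          ≈⟨ +-cong (*-congʳ (trans (ι-+ 3 (2 ℕ.* n)) (+-congˡ (ι-* 2 n))))
                    (*-congʳ (trans (ι-* 2 (suc n)) (*-congˡ (ι-suc n)))) ⟩
        (ι 3 + ι 2 * N) * (T₁ + u * T₁) + ι 2 * (1# + N) * (u * T₀) ∎

      factor : ∀ N v T₂ T₀ p u →
        (ι 2 + N) * (ι 4 * (ι 4 * v) * T₂) + ι 16 * (1# + N) * (p * (v * T₀)) + ι 16 * v * (ι 2 * (1# + N) * (u * T₀))
        ≈ ι 16 * v * ((ι 2 + N) * T₂ + (1# + N) * ((p + ι 2 * u) * T₀))
      factor = solve 6 (λ N v T₂ T₀ p u →
        (con 2 :+ N) :* (con 4 :* (con 4 :* v) :* T₂) :+ con 16 :* (con 1 :+ N) :* (p :* (v :* T₀))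
          :+ con 16 :* v :* (con 2 :* (con 1 :+ N) :* (u :* T₀))
        := con 16 :* v :* ((con 2 :+ N) :* T₂ :+ (con 1 :+ N) :* ((p :+ con 2 :* u) :* T₀))) ≈-refl

      square : ∀ u T → (1# + u * u) * T ≈ T + u * (u * T)
      square = solve 2 (λ u T → (con 1 :+ u :* u) :* T := T :+ u :* (u :* T)) ≈-refl

      expand : ∀ N v T₁ T₀ u →
        ι 16 * v * ((ι 3 + ι 2 * N) * (T₁ + u * T₁) + ι 2 * (1# + N) * (u * T₀))
        ≈ (ι 4 * N + ι 6) * (ι 2 * (1# + u) * (ι 4 * v * T₁)) + ι 16 * v * (ι 2 * (1# + N) * (u * T₀))
      expand = solve 5 (λ N v T₁ T₀ u →
        con 16 :* v :* ((con 3 :+ con 2 :* N) :* (T₁ :+ u :* T₁) :+ con 2 :* (con 1 :+ N) :* (u :* T₀))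
        := (con 4 :* N :+ con 6) :* (con 2 :* (con 1 :+ u) :* (con 4 :* v :* T₁)) :+ con 16 :* v :* (con 2 :* (con 1 :+ N) :* (u :* T₀))) ≈-refl

  -- The second hypothesis is y z = (1 - u)², stated without subtraction.
  central-binomial-convolution : TorsionFree → ∀ {y z u} →
    y + z ≈ ι 2 * (1# + u) → y * z + ι 2 * u ≈ 1# + u * u → ∀ n →
    ∑[ k ≤ n ] (ι (centralBinomial k ℕ.* centralBinomial (n ∸ k)) * (y ^ k * z ^ (n ∸ k)))
      ≈ ι (4 ℕ.^ n) * binomial²-polynomial u n
  central-binomial-convolution torsionFree {y} {z} {u} s≈ p≈ n = begin
    ∑[ k ≤ n ] (ι (centralBinomial k ℕ.* centralBinomial (n ∸ k)) * (y ^ k * z ^ (n ∸ k)))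
      ≈⟨ ∑-cong n (λ {k} _ → split (centralBinomial k) (centralBinomial (n ∸ k)) (y ^ k) (z ^ (n ∸ k))) ⟩
    (f ⋆ g) n
      ≈⟨ recurrence-unique torsionFree (⋆-recurrence (centralBinomialSeries y) (centralBinomialSeries z))
                           (scaled-binomial²-recurrence s≈ p≈) initial₀ initial₁ n ⟩
    ι (4 ℕ.^ n) * binomial²-polynomial u n ∎
    where
    f g : ℕ → Carrier
    f i = ι (centralBinomial i) * y ^ i
    g i = ι (centralBinomial i) * z ^ i

    split : ∀ a b Y Z → ι (a ℕ.* b) * (Y * Z) ≈ ι a * Y * (ι b * Z)
    split a b Y Z = trans (*-congʳ (ι-* a b)) (solve 4 (λ A B Y Z → A :* B :* (Y :* Z) := A :* Y :* (B :* Z)) ≈-refl _ _ Y Z)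

    initial₀ : (f ⋆ g) 0 ≈ ι 1 * binomial²-polynomial u 0
    initial₀ = *-congʳ (*-identityˡ 1#)

    initial₁ : (f ⋆ g) 1 ≈ ι 4 * binomial²-polynomial u 1
    initial₁ = begin
      (f ⋆ g) 1
        ≈⟨ solve 2 (λ y z → con 1 :* con 1 :* (con 2 :* (z :* con 1)) :+ con 2 :* (y :* con 1) :* (con 1 :* con 1)
                            := con 2 :* (y :+ z)) ≈-refl y z ⟩
      ι 2 * (y + z)
        ≈⟨ *-congˡ s≈ ⟩
      ι 2 * (ι 2 * (1# + u))
        ≈⟨ solve 1 (λ u → con 2 :* (con 2 :* (con 1 :+ u)) := con 4 :* (con 1 :* con 1 :+ con 1 :* (u :* con 1))) ≈-refl u ⟩
      ι 4 * binomial²-polynomial u 1 ∎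

-- ⟨ a , b ⟩ stands for a + b φ, where φ² = φ + 1.
data ℤ[φ] : Set where
  ⟨_,_⟩ : ℤ → ℤ → ℤ[φ]

infixl 6 _⊕_
infixl 7 _⊗_

_⊕_ _⊗_ : ℤ[φ] → ℤ[φ] → ℤ[φ]
⟨ a , b ⟩ ⊕ ⟨ c , d ⟩ = ⟨ a ℤ.+ c , b ℤ.+ d ⟩
⟨ a , b ⟩ ⊗ ⟨ c , d ⟩ = ⟨ a ℤ.* c ℤ.+ b ℤ.* d , a ℤ.* d ℤ.+ b ℤ.* c ℤ.+ b ℤ.* d ⟩

⊖_ : ℤ[φ] → ℤ[φ]
⊖ ⟨ a , b ⟩ = ⟨ ℤ.- a , ℤ.- b ⟩

𝟘 𝟙 φ : ℤ[φ]
𝟘 = ⟨ + 0 , + 0 ⟩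
𝟙 = ⟨ + 1 , + 0 ⟩
φ = ⟨ + 0 , + 1 ⟩

ℤ[φ]-isCommutativeRing : IsCommutativeRing _≡_ _⊕_ _⊗_ ⊖_ 𝟘 𝟙
ℤ[φ]-isCommutativeRing = record
  { isRing = record
    { +-isAbelianGroup = record
      { isGroup = record
        { isMonoid = record
          { isSemigroup = record
            { isMagma = record { isEquivalence = ≡.isEquivalence ; ∙-cong = ≡.cong₂ _⊕_ }
            ; assoc   = λ { ⟨ a , b ⟩ ⟨ c , d ⟩ ⟨ e , f ⟩ → ⟨,⟩-cong (ℤ.+-assoc a c e) (ℤ.+-assoc b d f) }
            }
          ; identity = (λ { ⟨ a , b ⟩ → ⟨,⟩-cong (ℤ.+-identityˡ a) (ℤ.+-identityˡ b) })
                     , (λ { ⟨ a , b ⟩ → ⟨,⟩-cong (ℤ.+-identityʳ a) (ℤ.+-identityʳ b) })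
          }
        ; inverse = (λ { ⟨ a , b ⟩ → ⟨,⟩-cong (ℤ.+-inverseˡ a) (ℤ.+-inverseˡ b) })
                  , (λ { ⟨ a , b ⟩ → ⟨,⟩-cong (ℤ.+-inverseʳ a) (ℤ.+-inverseʳ b) })
        ; ⁻¹-cong = ≡.cong ⊖_
        }
      ; comm = λ { ⟨ a , b ⟩ ⟨ c , d ⟩ → ⟨,⟩-cong (ℤ.+-comm a c) (ℤ.+-comm b d) }
      }
    ; *-cong     = ≡.cong₂ _⊗_
    ; *-assoc    = λ { ⟨ a , b ⟩ ⟨ c , d ⟩ ⟨ e , f ⟩ →
                       ⟨,⟩-cong (ℤ-solve (a ∷ b ∷ c ∷ d ∷ e ∷ f ∷ [])) (ℤ-solve (a ∷ b ∷ c ∷ d ∷ e ∷ f ∷ [])) }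
    ; *-identity = (λ { ⟨ a , b ⟩ → ⟨,⟩-cong (ℤ-solve (a ∷ b ∷ [])) (ℤ-solve (a ∷ b ∷ [])) })
                 , (λ { ⟨ a , b ⟩ → ⟨,⟩-cong (ℤ-solve (a ∷ b ∷ [])) (ℤ-solve (a ∷ b ∷ [])) })
    ; distrib    = (λ { ⟨ a , b ⟩ ⟨ c , d ⟩ ⟨ e , f ⟩ →
                        ⟨,⟩-cong (ℤ-solve (a ∷ b ∷ c ∷ d ∷ e ∷ f ∷ [])) (ℤ-solve (a ∷ b ∷ c ∷ d ∷ e ∷ f ∷ [])) })
                 , (λ { ⟨ a , b ⟩ ⟨ c , d ⟩ ⟨ e , f ⟩ →
                        ⟨,⟩-cong (ℤ-solve (a ∷ b ∷ c ∷ d ∷ e ∷ f ∷ [])) (ℤ-solve (a ∷ b ∷ c ∷ d ∷ e ∷ f ∷ [])) })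
    }
  ; *-comm = λ { ⟨ a , b ⟩ ⟨ c , d ⟩ → ⟨,⟩-cong (ℤ-solve (a ∷ b ∷ c ∷ d ∷ [])) (ℤ-solve (a ∷ b ∷ c ∷ d ∷ [])) }
  }
  where
  ⟨,⟩-cong : ∀ {a b c d} → a ≡ c → b ≡ d → ⟨ a , b ⟩ ≡ ⟨ c , d ⟩
  ⟨,⟩-cong = ≡.cong₂ ⟨_,_⟩

ℤ[φ]-commutativeRing : CommutativeRing _ _
ℤ[φ]-commutativeRing = record { isCommutativeRing = ℤ[φ]-isCommutativeRing }

open CentralBinomialConvolution ℤ[φ]-commutativeRing
  using (ι; ι-suc; ι-*; ι-^; ∑; TorsionFree; binomial²-polynomial; central-binomial-convolution)

ι≡⟨n,0⟩ : ∀ n → ι n ≡ ⟨ + n , + 0 ⟩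
ι≡⟨n,0⟩ zero    = refl
ι≡⟨n,0⟩ (suc n) = ≡.trans (ι-suc n) (≡.cong (𝟙 ⊕_) (ι≡⟨n,0⟩ n))

⟨,⟩-injective : ∀ {a b c d} → ⟨ a , b ⟩ ≡ ⟨ c , d ⟩ → a ≡ c × b ≡ d
⟨,⟩-injective refl = refl , refl

ι⊗ : ∀ n a b → ι n ⊗ ⟨ a , b ⟩ ≡ ⟨ + n ℤ.* a , + n ℤ.* b ⟩
ι⊗ n a b = ≡.trans (≡.cong (_⊗ ⟨ a , b ⟩) (ι≡⟨n,0⟩ n)) (scale (+ n) a b)
  where
  scale : ∀ c a b → ⟨ c , + 0 ⟩ ⊗ ⟨ a , b ⟩ ≡ ⟨ c ℤ.* a , c ℤ.* b ⟩
  scale c a b = ≡.cong₂ ⟨_,_⟩ (ℤ-solve (c ∷ a ∷ b ∷ [])) (ℤ-solve (c ∷ a ∷ b ∷ []))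

ℤ[φ]-torsionFree : TorsionFree
ℤ[φ]-torsionFree n {⟨ a , b ⟩} {⟨ c , d ⟩} eq
  with ⟨,⟩-injective (≡.trans (≡.sym (ι⊗ (suc n) a b)) (≡.trans eq (ι⊗ (suc n) c d)))
... | a≡c , b≡d = ≡.cong₂ ⟨_,_⟩ (ℤ.*-cancelˡ-≡ (+ suc n) a c a≡c) (ℤ.*-cancelˡ-≡ (+ suc n) b d b≡d)

sumTo-cong : ∀ n {f g : ℕ → ℤ} → (∀ k → f k ≡ g k) → sumTo n f ≡ sumTo n g
sumTo-cong zero    f≡g = f≡g 0
sumTo-cong (suc n) f≡g = ≡.cong₂ ℤ._+_ (sumTo-cong n f≡g) (f≡g (suc n))

module Gibonacci (G : ℤ → ℤ) (G-rec : ∀ s → G (+ 2 ℤ.+ s) ≡ G (+ 1 ℤ.+ s) ℤ.+ G s) where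

  open import Algebra.Properties.Semiring.Exp (CommutativeRing.semiring ℤ[φ]-commutativeRing)
    using (_^_; ^-assocʳ)
  open import Algebra.Properties.CommutativeSemiring.Exp (CommutativeRing.commutativeSemiring ℤ[φ]-commutativeRing)
    using (^-distrib-*)
  open import Algebra.Properties.CommutativeSemigroup (CommutativeRing.*-commutativeSemigroup ℤ[φ]-commutativeRing)
    using (x∙yz≈xz∙y)

  ev : ℤ → ℤ[φ] → ℤ
  ev r ⟨ a , b ⟩ = a ℤ.* G r ℤ.+ b ℤ.* G (+ 1 ℤ.+ r)

  ev-⊕ : ∀ r x y → ev r (x ⊕ y) ≡ ev r x ℤ.+ ev r y
  ev-⊕ r ⟨ a , b ⟩ ⟨ c , d ⟩ = distrib a b c d (G r) (G (+ 1 ℤ.+ r))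
    where
    distrib : ∀ a b c d g h → (a ℤ.+ c) ℤ.* g ℤ.+ (b ℤ.+ d) ℤ.* h ≡ (a ℤ.* g ℤ.+ b ℤ.* h) ℤ.+ (c ℤ.* g ℤ.+ d ℤ.* h)
    distrib = ℤ-solve-∀

  ev-∑ : ∀ r n f → ev r (∑ n f) ≡ sumTo n (λ k → ev r (f k))
  ev-∑ r zero    f = refl
  ev-∑ r (suc n) f = ≡.trans (ev-⊕ r (∑ n f) (f (suc n))) (≡.cong (ℤ._+ ev r (f (suc n))) (ev-∑ r n f))

  ev-ι : ∀ r n x → ev r (ι n ⊗ x) ≡ + n ℤ.* ev r x
  ev-ι r n ⟨ a , b ⟩ = ≡.trans (≡.cong (ev r) (ι⊗ n a b)) (linear (+ n) a b (G r) (G (+ 1 ℤ.+ r)))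
    where
    linear : ∀ c a b g h → c ℤ.* a ℤ.* g ℤ.+ c ℤ.* b ℤ.* h ≡ c ℤ.* (a ℤ.* g ℤ.+ b ℤ.* h)
    linear = ℤ-solve-∀

  ev-φ : ∀ r x → ev r (φ ⊗ x) ≡ ev (+ 1 ℤ.+ r) x
  ev-φ r ⟨ a , b ⟩ = ≡.trans (shifted a b (G r) (G (+ 1 ℤ.+ r))) (≡.cong (λ t → a ℤ.* G (+ 1 ℤ.+ r) ℤ.+ b ℤ.* t) G-rec′)
    where
    shifted : ∀ a b g₀ g₁ → (+ 0 ℤ.* a ℤ.+ + 1 ℤ.* b) ℤ.* g₀ ℤ.+ (+ 0 ℤ.* b ℤ.+ + 1 ℤ.* a ℤ.+ + 1 ℤ.* b) ℤ.* g₁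
                            ≡ a ℤ.* g₁ ℤ.+ b ℤ.* (g₁ ℤ.+ g₀)
    shifted = ℤ-solve-∀
    G-rec′ : G (+ 1 ℤ.+ r) ℤ.+ G r ≡ G (+ 1 ℤ.+ (+ 1 ℤ.+ r))
    G-rec′ = ≡.trans (≡.sym (G-rec r)) (≡.cong G (ℤ.+-assoc (+ 1) (+ 1) r))

  ev-φ^ : ∀ j r → ev r (φ ^ j) ≡ G (+ j ℤ.+ r)
  ev-φ^ zero    r = ≡.trans (unit (G r) (G (+ 1 ℤ.+ r))) (≡.cong G (≡.sym (ℤ.+-identityˡ r)))
    where
    unit : ∀ g h → + 1 ℤ.* g ℤ.+ + 0 ℤ.* h ≡ g
    unit = ℤ-solve-∀
  ev-φ^ (suc j) r = ≡.trans (ev-φ r (φ ^ j)) (≡.trans (ev-φ^ j (+ 1 ℤ.+ r)) (≡.cong G index))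
    where
    index : + j ℤ.+ (+ 1 ℤ.+ r) ≡ + suc j ℤ.+ r
    index = ≡.trans (≡.sym (ℤ.+-assoc (+ j) (+ 1) r)) (≡.cong (λ m → + m ℤ.+ r) (ℕ.+-comm j 1))

  ev-monomial : ∀ r N j → ev r (ι N ⊗ φ ^ j) ≡ + N ℤ.* G (+ j ℤ.+ r)
  ev-monomial r N j = ≡.trans (ev-ι r N (φ ^ j)) (≡.cong (+ N ℤ.*_) (ev-φ^ j r))

  gibonacci-identity : ∀ r n →
    sumTo n (λ k → + (((2 ℕ.* k) C k) ℕ.* ((2 ℕ.* (n ∸ k)) C (n ∸ k)) ℕ.* 5 ℕ.^ (n ∸ k)) ℤ.* G (+ (6 ℕ.* k) ℤ.+ r))
      ≡ + (4 ℕ.^ n) ℤ.* sumTo n (λ k → + ((n C k) ℕ.* (n C k) ℕ.* 4 ℕ.^ k) ℤ.* G (+ (2 ℕ.* k) ℤ.+ r))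
  gibonacci-identity r n = begin
    sumTo n (λ k → + (centralBinomial k ℕ.* centralBinomial (n ∸ k) ℕ.* 5 ℕ.^ (n ∸ k)) ℤ.* G (+ (6 ℕ.* k) ℤ.+ r))
      ≡⟨ ≡.trans (ev-∑ r n _) (sumTo-cong n lhs-term) ⟨
    ev r (∑[ k ≤ n ] (ι (centralBinomial k ℕ.* centralBinomial (n ∸ k)) ⊗ ((φ ^ 6) ^ k ⊗ ι 5 ^ (n ∸ k))))
      ≡⟨ ≡.cong (ev r) (central-binomial-convolution ℤ[φ]-torsionFree refl refl n) ⟩
    ev r (ι (4 ℕ.^ n) ⊗ binomial²-polynomial (ι 4 ⊗ φ ^ 2) n)
      ≡⟨ ev-ι r (4 ℕ.^ n) _ ⟩
    + (4 ℕ.^ n) ℤ.* ev r (binomial²-polynomial (ι 4 ⊗ φ ^ 2) n)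
      ≡⟨ ≡.cong (+ (4 ℕ.^ n) ℤ.*_) (≡.trans (ev-∑ r n _) (sumTo-cong n rhs-term)) ⟩
    + (4 ℕ.^ n) ℤ.* sumTo n (λ k → + (binomial² n k ℕ.* 4 ℕ.^ k) ℤ.* G (+ (2 ℕ.* k) ℤ.+ r)) ∎
    where
    open ≡-Reasoning
    lhs-term : ∀ k → ev r (ι (centralBinomial k ℕ.* centralBinomial (n ∸ k)) ⊗ ((φ ^ 6) ^ k ⊗ ι 5 ^ (n ∸ k)))
                     ≡ + (centralBinomial k ℕ.* centralBinomial (n ∸ k) ℕ.* 5 ℕ.^ (n ∸ k)) ℤ.* G (+ (6 ℕ.* k) ℤ.+ r)
    lhs-term k = ≡.trans (≡.cong (ev r) (begin
      ι a ⊗ ((φ ^ 6) ^ k ⊗ ι 5 ^ (n ∸ k))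
        ≡⟨ ≡.cong₂ (λ p q → ι a ⊗ (p ⊗ q)) (^-assocʳ φ 6 k) (≡.sym (ι-^ 5 (n ∸ k))) ⟩
      ι a ⊗ (φ ^ (6 ℕ.* k) ⊗ ι (5 ℕ.^ (n ∸ k)))
        ≡⟨ x∙yz≈xz∙y _ _ _ ⟩
      ι a ⊗ ι (5 ℕ.^ (n ∸ k)) ⊗ φ ^ (6 ℕ.* k)
        ≡⟨ ≡.cong (_⊗ φ ^ (6 ℕ.* k)) (≡.sym (ι-* a (5 ℕ.^ (n ∸ k)))) ⟩
      ι (a ℕ.* 5 ℕ.^ (n ∸ k)) ⊗ φ ^ (6 ℕ.* k)    ∎))
      (ev-monomial r (a ℕ.* 5 ℕ.^ (n ∸ k)) (6 ℕ.* k))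
      where
      a = centralBinomial k ℕ.* centralBinomial (n ∸ k)
    rhs-term : ∀ k → ev r (ι (binomial² n k) ⊗ (ι 4 ⊗ φ ^ 2) ^ k) ≡ + (binomial² n k ℕ.* 4 ℕ.^ k) ℤ.* G (+ (2 ℕ.* k) ℤ.+ r)
    rhs-term k = ≡.trans (≡.cong (ev r) (begin
      ι b ⊗ (ι 4 ⊗ φ ^ 2) ^ k
        ≡⟨ ≡.cong (ι b ⊗_) (^-distrib-* (ι 4) (φ ^ 2) k) ⟩
      ι b ⊗ (ι 4 ^ k ⊗ (φ ^ 2) ^ k)
        ≡⟨ ≡.cong₂ (λ p q → ι b ⊗ (p ⊗ q)) (≡.sym (ι-^ 4 k)) (^-assocʳ φ 2 k) ⟩
      ι b ⊗ (ι (4 ℕ.^ k) ⊗ φ ^ (2 ℕ.* k))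
        ≡⟨ ≡.sym (CommutativeRing.*-assoc ℤ[φ]-commutativeRing _ _ _) ⟩
      ι b ⊗ ι (4 ℕ.^ k) ⊗ φ ^ (2 ℕ.* k)
        ≡⟨ ≡.cong (_⊗ φ ^ (2 ℕ.* k)) (≡.sym (ι-* b (4 ℕ.^ k))) ⟩
      ι (b ℕ.* 4 ℕ.^ k) ⊗ φ ^ (2 ℕ.* k) ∎))
      (ev-monomial r (b ℕ.* 4 ℕ.^ k) (2 ℕ.* k))
      where
      b = binomial² n k

F-rec : ∀ s → F (+ 2 ℤ.+ s) ≡ F (+ 1 ℤ.+ s) ℤ.+ F s
F-rec (+ n)                = refl
F-rec -[1+ 0 ]             = refl
F-rec -[1+ 1 ]             = refl
F-rec -[1+ suc (suc m) ] = alternating (sgn m) (+ fibℕ (suc m)) (+ fibℕ (2 ℕ.+ m))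
  where
  alternating : ∀ σ a b → σ ℤ.* a ≡ ℤ.- σ ℤ.* b ℤ.+ ℤ.- (ℤ.- σ) ℤ.* (b ℤ.+ a)
  alternating = ℤ-solve-∀

L-rec : ∀ s → L (+ 2 ℤ.+ s) ≡ L (+ 1 ℤ.+ s) ℤ.+ L s
L-rec (+ n)                = refl
L-rec -[1+ 0 ]             = refl
L-rec -[1+ 1 ]             = refl
L-rec -[1+ suc (suc m) ] = alternating (sgn m) (+ lucℕ (suc m)) (+ lucℕ (2 ℕ.+ m))
  where
  alternating : ∀ σ a b → ℤ.- (σ ℤ.* a) ≡ ℤ.- (ℤ.- σ ℤ.* b) ℤ.+ ℤ.- (ℤ.- (ℤ.- σ) ℤ.* (b ℤ.+ a))
  alternating = ℤ-solve-∀

open import Data.Nat using (_^_)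

theorem29 : (r : ℤ) (n : ℕ) →
    (sumTo n (λ k → + (((2 ℕ.* k) C k) ℕ.* ((2 ℕ.* (n ∸ k)) C (n ∸ k)) ℕ.* 5 ^ (n ∸ k)) ℤ.* F (+ (6 ℕ.* k) ℤ.+ r))
      ≡ + (4 ^ n) ℤ.* sumTo n (λ k → + ((n C k) ℕ.* (n C k) ℕ.* 4 ^ k) ℤ.* F (+ (2 ℕ.* k) ℤ.+ r)))
    × (sumTo n (λ k → + (((2 ℕ.* k) C k) ℕ.* ((2 ℕ.* (n ∸ k)) C (n ∸ k)) ℕ.* 5 ^ (n ∸ k)) ℤ.* L (+ (6 ℕ.* k) ℤ.+ r))
      ≡ + (4 ^ n) ℤ.* sumTo n (λ k → + ((n C k) ℕ.* (n C k) ℕ.* 4 ^ k) ℤ.* L (+ (2 ℕ.* k) ℤ.+ r)))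
theorem29 r n = Gibonacci.gibonacci-identity F F-rec r n , Gibonacci.gibonacci-identity L L-rec r n
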